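{- Let $\mathbf M$ be a cyclic pointed residuated $\mathbf S$-bimodule with point $0$. For all $x,y\in M$ and $a\in S$, computing in the Nagata product $\mathbf S\ltimes\mathbf M$: $$e_M(x*a)=\gamma(e_M x\circ e_S a),\quad e_S(x\backslash_r y)=\sigma(e_M x\backslash e_M y),\quad e_M(a\backslash_\ell x)=\gamma(e_S a\backslash e_M x),$$ $$e_M(a*x)=\gamma(e_S a\circ e_M x),\quad e_S(x/_\ell y)=\sigma(e_M x/e_M y),\quad e_M(x/_r a)=\gamma(e_M x/e_S a),$$ where the residuals on the right-hand sides exist in $\mathbf S\ltimes\mathbf M$.
   Context: $\mathbf S$ is a posemigroup (poset with isotone associative multiplication), $\mathbf M=\langle M,\vee\rangle$ a join semilattice; elements of $S$ are $a,b$, of $M$ are $x,y$. A residuated $\mathbf S$-bimodule: isotone actions $a*x,x*a\in M$ with $(ab)*x=a*(b*x)$, $x*(ab)=(x*a)*b$, $(a*x)*b=a*(x*b)$, distributing over $\vee$, and maps $\backslash_\ell:S\times M\to M$, $/_\ell:M\times M\to S$, $\backslash_r:M\times M\to S$, $/_r:M\times S\to M$ with $x\le a\backslash_\ell y\iff a*x\le y\iff a\le y/_\ell x$ and $x\le y/_r a\iff x*a\le y\iff a\le x\backslash_r y$. Cyclic pointed: $0\in M$ with $a*0=0*a$ for all $a$. The Nagata product $\mathbf S\ltimes\mathbf M$: $S\times M$ with componentwise order and $\langle a,x\rangle\circ\langle b,y\rangle=\langle ab,x*b\vee a*y\rangle$; residuals $m\backslash n$, $n/m$ denote the greatest $k$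 with $m\circ k\le n$, resp. $k\circ m\le n$. Maps: $\sigma\langle a,x\rangle=\langle a,a*0\rangle$, $\gamma\langle a,x\rangle=\langle 0\backslash_r x,x\rangle$, $e_S(a)=\langle a,a*0\rangle$, $e_M(x)=\langle 0\backslash_r x,x\rangle$. -}

module Defs where

open import Level using (Level; _⊔_) renaming (suc to lsuc)
open import Relation.Binary.Core using (Rel)
open import Relation.Binary.Structures using (IsPartialOrder)
open import Relation.Binary.Lattice.Structures using (IsJoinSemilattice)
open import Relation.Binary.PropositionalEquality using (_≡_)
open import Data.Product using (_×_; _,_; proj₁; proj₂)

record Posemigroup (c ℓ : Level) : Set (lsuc (c ⊔ ℓ)) where
  infixl 7 _·_
  infix 4 _≤_
  field
    Carrier        : Set c
    _≤_            : Rel Carrier ℓ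
    _·_            : Carrier → Carrier → Carrier
    isPartialOrder : IsPartialOrder _≡_ _≤_
    assoc          : ∀ a b d → (a · b) · d ≡ a · (b · d)
    ·-mono         : ∀ {a a′ b b′} → a ≤ a′ → b ≤ b′ → a · b ≤ a′ · b′

-- A residuated S-bimodule over a join semilattice M = ⟨M, ∨⟩.
-- a *ₗ x  is  a*x ,  x *ᵣ a  is  x*a ;
-- a ⧵ₗ y , y /ₗ x , x ⧵ᵣ y , y /ᵣ a  are  \_ℓ, /_ℓ, \_r, /_r.
record ResBimodule {c ℓ : Level} (S : Posemigroup c ℓ) (m ℓm : Level)
       : Set (lsuc (c ⊔ ℓ ⊔ m ⊔ ℓm)) where
  open Posemigroup S renaming (Carrier to SC; _≤_ to _≤S_)
  infix 4 _⊑_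
  infixr 6 _∨_
  field
    M                 : Set m
    _⊑_               : Rel M ℓm
    _∨_               : M → M → M
    isJoinSemilattice : IsJoinSemilattice _≡_ _⊑_ _∨_
    _*ₗ_              : SC → M → M
    _*ᵣ_              : M → SC → M
    *ₗ-mono           : ∀ {a b x y} → a ≤S b → x ⊑ y → (a *ₗ x) ⊑ (b *ₗ y)
    *ᵣ-mono           : ∀ {a b x y} → x ⊑ y → a ≤S b → (x *ᵣ a) ⊑ (y *ᵣ b)
    *ₗ-assoc          : ∀ a b x → (a · b) *ₗ x ≡ a *ₗ (b *ₗ x)
    *ᵣ-assoc          : ∀ x a b → x *ᵣ (a · b) ≡ (x *ᵣ a) *ᵣ b
    *ₗᵣ-assoc         : ∀ a x b → (a *ₗ x) *ᵣ b ≡ a *ₗ (x *ᵣ b)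
    *ₗ-distrib        : ∀ a x y → a *ₗ (x ∨ y) ≡ (a *ₗ x) ∨ (a *ₗ y)
    *ᵣ-distrib        : ∀ x y a → (x ∨ y) *ᵣ a ≡ (x *ᵣ a) ∨ (y *ᵣ a)
    _⧵ₗ_              : SC → M → M
    _/ₗ_              : M → M → SC
    _⧵ᵣ_              : M → M → SC
    _/ᵣ_              : M → SC → M
    resₗ₁             : ∀ a x y → (x ⊑ a ⧵ₗ y → a *ₗ x ⊑ y) × (a *ₗ x ⊑ y → x ⊑ a ⧵ₗ y)
    resₗ₂             : ∀ a x y → (a *ₗ x ⊑ y → a ≤S y /ₗ x) × (a ≤S y /ₗ x → a *ₗ x ⊑ y)
    resᵣ₁             : ∀ a x y → (x ⊑ y /ᵣ a → x *ᵣ a ⊑ y) × (x *ᵣ a ⊑ y → x ⊑ y /ᵣ a)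
    resᵣ₂             : ∀ a x y → (x *ᵣ a ⊑ y → a ≤S x ⧵ᵣ y) × (a ≤S x ⧵ᵣ y → x *ᵣ a ⊑ y)

record CyclicPointed {c ℓ : Level} (S : Posemigroup c ℓ) (m ℓm : Level)
       : Set (lsuc (c ⊔ ℓ ⊔ m ⊔ ℓm)) where
  field
    bimodule : ResBimodule S m ℓm
  open ResBimodule bimodule
  field
    𝟎      : M
    cyclic : ∀ a → a *ₗ 𝟎 ≡ 𝟎 *ᵣ a

module Nagata {c ℓ m ℓm : Level} {S : Posemigroup c ℓ}
              (P : CyclicPointed S m ℓm) where
  open Posemigroup S renaming (Carrier to SC; _≤_ to _≤S_)
  open CyclicPointed P
  open ResBimodule bimodule

  N : Set (c ⊔ m)
  N = SC × M

  infix 4 _≤N_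
  _≤N_ : N → N → Set (ℓ ⊔ ℓm)
  p ≤N q = (proj₁ p ≤S proj₁ q) × (proj₂ p ⊑ proj₂ q)

  infixl 7 _∘_
  _∘_ : N → N → N
  (a , x) ∘ (b , y) = (a · b , (x *ᵣ b) ∨ (a *ₗ y))

  IsLeftResidual : N → N → N → Set (c ⊔ m ⊔ ℓ ⊔ ℓm)
  IsLeftResidual p q k = (p ∘ k ≤N q) × (∀ j → p ∘ j ≤N q → j ≤N k)

  IsRightResidual : N → N → N → Set (c ⊔ m ⊔ ℓ ⊔ ℓm)
  IsRightResidual q p k = (k ∘ p ≤N q) × (∀ j → j ∘ p ≤N q → j ≤N k)

  σ : N → N
  σ (a , x) = (a , a *ₗ 𝟎)

  γ : N → N
  γ (a , x) = (𝟎 ⧵ᵣ x , x)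

  eS : SC → N
  eS a = (a , a *ₗ 𝟎)

  eM : M → N
  eM x = (𝟎 ⧵ᵣ x , x)

{-# OPTIONS --safe #-}
module Submission where

-- Call ⟨a , x⟩ ∈ S ⋉ M grounded when ⟨a , x⟩ ≤ γ⟨a , x⟩, i.e. 0 * a ≤ x.  Every
-- e_M x and, by cyclicity, every e_S a is grounded; a product with a grounded
-- factor on either side is grounded; and a grounded element lies below e_M y
-- as soon as its M-component lies below y.  So the S-component never
-- constrains a residual into e_M y, which is therefore computed from the
-- residuals of the bimodule alone; likewise the M-component of e_M x ∘ e_S a
-- collapses to x * a, and that of e_S a ∘ e_M x to a * x.

open import Defs
open import Level using (Level; _⊔_)
open import Relation.Binary.PropositionalEquality using (_≡_; refl; sym; trans; cong)
open import Data.Product using (_×_; _,_; proj₁; proj₂; ∃)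
open import Relation.Binary.Structures using (IsPartialOrder)
open import Relation.Binary.Lattice.Bundles using (JoinSemilattice)
import Relation.Binary.Lattice.Properties.JoinSemilattice as JoinSemilatticeProperties
import Relation.Binary.Reasoning.PartialOrder as PosetReasoning

module NagataResiduals {c ℓ m ℓm : Level} {S : Posemigroup c ℓ}
                       (P : CyclicPointed S m ℓm) where
  open Posemigroup S using (_·_; isPartialOrder)
  open CyclicPointed P
  open ResBimodule bimodule
  open Nagata P
  module ≤S = IsPartialOrder isPartialOrder

  M-joinSemilattice : JoinSemilattice m m ℓm
  M-joinSemilattice = record { isJoinSemilattice = isJoinSemilattice }

  open JoinSemilattice M-joinSemilattice
    using (x≤x∨y; y≤x∨y; ∨-least)
    renaming (refl to ⊑-refl; reflexive to ⊑-reflexive; trans to ⊑-trans)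
  open JoinSemilatticeProperties M-joinSemilattice using (∨-comm; x≤y⇒x∨y≈y)
  open PosetReasoning (JoinSemilattice.poset M-joinSemilattice)

  y⊑x⇒x∨y≡x : ∀ {x y} → y ⊑ x → x ∨ y ≡ x
  y⊑x⇒x∨y≡x {x} {y} y⊑x = trans (∨-comm x y) (x≤y⇒x∨y≈y y⊑x)

  Grounded : N → Set (ℓ ⊔ ℓm)
  Grounded p = p ≤N γ p

  grounded⇒𝟎*ᵣ⊑ : ∀ {a x} → Grounded (a , x) → 𝟎 *ᵣ a ⊑ x
  grounded⇒𝟎*ᵣ⊑ {a} {x} (a≤ , _) = proj₂ (resᵣ₂ a 𝟎 x) a≤

  𝟎*ᵣ⊑⇒grounded : ∀ {a x} → 𝟎 *ᵣ a ⊑ x → Grounded (a , x)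
  𝟎*ᵣ⊑⇒grounded {a} {x} 𝟎a⊑x = proj₁ (resᵣ₂ a 𝟎 x) 𝟎a⊑x , ⊑-refl

  eM-grounded : ∀ x → Grounded (eM x)
  eM-grounded x = ≤S.refl , ⊑-refl

  eS-grounded : ∀ a → Grounded (eS a)
  eS-grounded a = 𝟎*ᵣ⊑⇒grounded (⊑-reflexive (sym (cyclic a)))

  ∘-groundedˡ : ∀ {p} q → Grounded p → Grounded (p ∘ q)
  ∘-groundedˡ {a , x} (b , y) gp = 𝟎*ᵣ⊑⇒grounded (begin
    𝟎 *ᵣ (a · b)                ≡⟨ *ᵣ-assoc 𝟎 a b ⟩
    (𝟎 *ᵣ a) *ᵣ b              ≤⟨ *ᵣ-mono (grounded⇒𝟎*ᵣ⊑ gp) ≤S.refl ⟩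
    x *ᵣ b                      ≤⟨ x≤x∨y _ _ ⟩
    (x *ᵣ b) ∨ (a *ₗ y)         ∎)

  ∘-groundedʳ : ∀ p {q} → Grounded q → Grounded (p ∘ q)
  ∘-groundedʳ (a , x) {b , y} gq = 𝟎*ᵣ⊑⇒grounded (begin
    𝟎 *ᵣ (a · b)                ≡⟨ *ᵣ-assoc 𝟎 a b ⟩
    (𝟎 *ᵣ a) *ᵣ b              ≡⟨ cong (_*ᵣ b) (cyclic a) ⟨
    (a *ₗ 𝟎) *ᵣ b              ≡⟨ *ₗᵣ-assoc a 𝟎 b ⟩
    a *ₗ (𝟎 *ᵣ b)              ≤⟨ *ₗ-mono ≤S.refl (grounded⇒𝟎*ᵣ⊑ gq) ⟩
    a *ₗ y                      ≤⟨ y≤x∨y _ _ ⟩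
    (x *ᵣ b) ∨ (a *ₗ y)         ∎)

  grounded-≤N-eM : ∀ {a x y} → Grounded (a , x) → x ⊑ y → (a , x) ≤N eM y
  grounded-≤N-eM {a} {x} {y} gp x⊑y =
    proj₁ (resᵣ₂ a 𝟎 y) (⊑-trans (grounded⇒𝟎*ᵣ⊑ gp) x⊑y) , x⊑y

  ∘-eS-proj₂ : ∀ {a x} → Grounded (a , x) → ∀ b → proj₂ ((a , x) ∘ eS b) ≡ x *ᵣ b
  ∘-eS-proj₂ {a} {x} gp b = y⊑x⇒x∨y≡x (begin
    a *ₗ (b *ₗ 𝟎)               ≡⟨ cong (a *ₗ_) (cyclic b) ⟩
    a *ₗ (𝟎 *ᵣ b)               ≡⟨ *ₗᵣ-assoc a 𝟎 b ⟨
    (a *ₗ 𝟎) *ᵣ b               ≡⟨ cong (_*ᵣ b) (cyclic a) ⟩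
    (𝟎 *ᵣ a) *ᵣ b               ≤⟨ *ᵣ-mono (grounded⇒𝟎*ᵣ⊑ gp) ≤S.refl ⟩
    x *ᵣ b                      ∎)

  eS-∘-proj₂ : ∀ {a x} → Grounded (a , x) → ∀ b → proj₂ (eS b ∘ (a , x)) ≡ b *ₗ x
  eS-∘-proj₂ {a} {x} gp b = x≤y⇒x∨y≈y (begin
    (b *ₗ 𝟎) *ᵣ a               ≡⟨ *ₗᵣ-assoc b 𝟎 a ⟩
    b *ₗ (𝟎 *ᵣ a)               ≤⟨ *ₗ-mono ≤S.refl (grounded⇒𝟎*ᵣ⊑ gp) ⟩
    b *ₗ x                      ∎)

  isLeftResidual-eM : ∀ {a x} → Grounded (a , x) → ∀ y →
                      IsLeftResidual (a , x) (eM y) (x ⧵ᵣ y , a ⧵ₗ y)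
  isLeftResidual-eM {a} {x} gp y = below , greatest
    where
    below : (a , x) ∘ (x ⧵ᵣ y , a ⧵ₗ y) ≤N eM y
    below = grounded-≤N-eM (∘-groundedˡ (x ⧵ᵣ y , a ⧵ₗ y) gp)
      (∨-least (proj₂ (resᵣ₂ (x ⧵ᵣ y) x y) ≤S.refl) (proj₁ (resₗ₁ a (a ⧵ₗ y) y) ⊑-refl))
    greatest : ∀ j → (a , x) ∘ j ≤N eM y → j ≤N (x ⧵ᵣ y , a ⧵ₗ y)
    greatest (b , z) (_ , ∘⊑y) =
      proj₁ (resᵣ₂ b x y) (⊑-trans (x≤x∨y _ _) ∘⊑y) ,
      proj₂ (resₗ₁ a z y) (⊑-trans (y≤x∨y _ _) ∘⊑y)

  isRightResidual-eM : ∀ {a x} → Grounded (a , x) → ∀ y →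
                       IsRightResidual (eM y) (a , x) (y /ₗ x , y /ᵣ a)
  isRightResidual-eM {a} {x} gp y = below , greatest
    where
    below : (y /ₗ x , y /ᵣ a) ∘ (a , x) ≤N eM y
    below = grounded-≤N-eM (∘-groundedʳ (y /ₗ x , y /ᵣ a) gp)
      (∨-least (proj₁ (resᵣ₁ a (y /ᵣ a) y) ⊑-refl) (proj₂ (resₗ₂ (y /ₗ x) x y) ≤S.refl))
    greatest : ∀ j → j ∘ (a , x) ≤N eM y → j ≤N (y /ₗ x , y /ᵣ a)
    greatest (b , z) (_ , ∘⊑y) =
      proj₁ (resₗ₂ b x y) (⊑-trans (y≤x∨y _ _) ∘⊑y) ,
      proj₂ (resᵣ₁ a z y) (⊑-trans (x≤x∨y _ _) ∘⊑y)

mainTheorem11 : ∀ {c ℓ m ℓm : Level} (S : Posemigroup c ℓ) (P : CyclicPointed S m ℓm) →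
  let open Posemigroup S
      open CyclicPointed P
      open ResBimodule bimodule
      open Nagata P
  in ∀ (x y : M) (a : Carrier) →
     (eM (x *ᵣ a) ≡ γ (eM x ∘ eS a))
     × (∃ λ k → IsLeftResidual (eM x) (eM y) k × (eS (x ⧵ᵣ y) ≡ σ k))
     × (∃ λ k → IsLeftResidual (eS a) (eM x) k × (eM (a ⧵ₗ x) ≡ γ k))
     × (eM (a *ₗ x) ≡ γ (eS a ∘ eM x))
     × (∃ λ k → IsRightResidual (eM x) (eM y) k × (eS (x /ₗ y) ≡ σ k))
     × (∃ λ k → IsRightResidual (eM x) (eS a) k × (eM (x /ᵣ a) ≡ γ k))
mainTheorem11 S P x y a =
  cong eM (sym (∘-eS-proj₂ (eM-grounded x) a)) ,
  (_ , isLeftResidual-eM (eM-grounded x) y , refl) ,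
  (_ , isLeftResidual-eM (eS-grounded a) x , refl) ,
  cong eM (sym (eS-∘-proj₂ (eM-grounded x) a)) ,
  (_ , isRightResidual-eM (eM-grounded y) x , refl) ,
  (_ , isRightResidual-eM (eS-grounded a) x , refl)
  where open Nagata P
        open NagataResiduals P
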